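{- Assume the Erdős–Sós conjecture holds. Let $k\ge k'\ge 0$ be integers and let $G$ be a graph on $n\ge 3k^3$ vertices with $\Delta(G)\le k-1$ and $e(G)\ge \frac{k'n}{2}+3k^3$. Then for any $N\le 2k$ and any trees $T_1,\dots,T_N$ each having at most $k'+2$ vertices, $G$ contains the vertex-disjoint union $T_1\cup\cdots\cup T_N$ as a subgraph.
   Context: The Erdős–Sós conjecture states that for every tree $T$ and every $m$, every $m$-vertex graph with more than $\frac{|T|-2}{2}m$ edges contains a copy of $T$ (equivalently $\mathrm{ex}(m,T)\le\frac{|T|-2}{2}m$), where $|T|$ is the number of vertices of $T$. $\Delta(G)$ is the maximum degree and $e(G)$ the number of edges of $G$. -}

module Defs where

open import Data.Nat using (ℕ; zero; suc; _+_; _*_; _∸_; _^_; _≤_; _<_; _<ᵇ_)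
open import Data.Bool using (Bool; true; false; if_then_else_; _∧_)
open import Data.Fin using (Fin; toℕ)
open import Data.List using (List; []; _∷_; _++_; length; map; allFin)
open import Data.Nat.ListAction using (sum)
open import Data.List.Relation.Unary.Unique.Propositional using (Unique)
open import Data.Product using (Σ; ∃; _×_)
open import Relation.Binary.PropositionalEquality using (_≡_; _≢_)
open import Relation.Nullary using (¬_)

record Graph (n : ℕ) : Set where
  field
    adj    : Fin n → Fin n → Bool
    sym    : ∀ u v → adj u v ≡ adj v u
    irrefl : ∀ v → adj v v ≡ false
open Graph public

private
  ind : Bool → ℕ
  ind true  = 1
  ind false = 0

degree : ∀ {n} → Graph n → Fin n → ℕ
degree {n} G v = sum (map (λ u → ind (adj G v u)) (allFin n))

-- Δ(G) ≤ d  (used with d = k ∸ 1 only when k ≥ 1; the statement uses deg + 1 ≤ k directly)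
MaxDegreeAtMost : ∀ {n} → Graph n → ℕ → Set
MaxDegreeAtMost G d = ∀ v → degree G v ≤ d

edges : ∀ {n} → Graph n → ℕ
edges {n} G = sum (map (λ i → sum (map (λ j → ind ((toℕ i <ᵇ toℕ j) ∧ adj G i j)) (allFin n))) (allFin n))

data Chain {n} (G : Graph n) : List (Fin n) → Set where
  nil  : Chain G []
  one  : ∀ v → Chain G (v ∷ [])
  cons : ∀ {u v vs} → adj G u v ≡ true → Chain G (v ∷ vs) → Chain G (u ∷ v ∷ vs)

data Reach {n} (G : Graph n) : Fin n → Fin n → Set where
  here : ∀ {u} → Reach G u u
  step : ∀ {u w v} → adj G u w ≡ true → Reach G w v → Reach G u v

Connected : ∀ {n} → Graph n → Set
Connected G = ∀ u v → Reach G u v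

HasCycle : ∀ {n} → Graph n → Set
HasCycle {n} G = Σ (Fin n) λ u → Σ (List (Fin n)) λ vs →
  (2 ≤ length vs) × Unique (u ∷ vs) × Chain G (u ∷ vs ++ u ∷ [])

IsTree : ∀ {t} → Graph t → Set
IsTree {t} T = (1 ≤ t) × Connected T × ¬ HasCycle T

IsEmbedding : ∀ {t n} → Graph t → Graph n → (Fin t → Fin n) → Set
IsEmbedding H G f = (∀ u v → f u ≡ f v → u ≡ v) × (∀ u v → adj H u v ≡ true → adj G (f u) (f v) ≡ true)

Contains : ∀ {n t} → Graph n → Graph t → Set
Contains G H = ∃ λ f → IsEmbedding H G f

-- Erdős–Sós: every m-vertex graph with more than (|T|-2)/2 · m edges contains T
-- (stated as 2 e(H) > (|T| ∸ 2) m)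
ErdosSos : Set
ErdosSos = ∀ (t : ℕ) (T : Graph t) → IsTree T →
           ∀ (m : ℕ) (H : Graph m) → (t ∸ 2) * m < 2 * edges H → Contains H T

ContainsDisjointUnion : ∀ {n N} → Graph n → (t : Fin N → ℕ) → ((i : Fin N) → Graph (t i)) → Set
ContainsDisjointUnion {n} {N} G t T =
  Σ ((i : Fin N) → Fin (t i) → Fin n) λ f →
    (∀ i → IsEmbedding (T i) G (f i)) ×
    (∀ i j (u : Fin (t i)) (v : Fin (t j)) → i ≢ j → f i u ≢ f j v)

{-# OPTIONS --safe #-}
module Submission where

-- The trees are embedded greedily. Deleting a vertex (here: isolating it, so the vertex set
-- stays Fin n) destroys at most Δ(G) ≤ k − 1 edges, so after placing fewer than 2k trees
-- and deleting their at most k' + 2 vertices each, fewer than 2k(k' + 2)(k − 1) < 3k³ edges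
-- are lost and more than k'n/2 remain. Erdős–Sós then embeds the next tree T (|T| ≤ k' + 2)
-- into what is left; if |T| ≥ 2 every vertex of T has a neighbour, so its image avoids the
-- isolated, i.e. used, vertices, and a one-vertex tree goes to an endpoint of a remaining edge.

open import Defs
open import Data.Bool using (Bool; true; false; not; _∧_; _∨_; T)
open import Data.Bool.Properties using (∨-comm; ∧-zeroʳ; ∧-conicalʳ)
open import Data.Empty using (⊥-elim)
open import Data.Fin using (Fin; zero; suc; toℕ)
open import Data.Fin.Patterns using (0F; 1F)
open import Data.Fin.Properties using (_≟_)
open import Data.List using (List; []; _∷_; length; map; foldl; allFin; tabulate)
open import Data.List.Membership.Propositional using (_∈_)
open import Data.List.Membership.Propositional.Properties using (∈-tabulate⁺)
open import Data.List.Relation.Unary.Any using (here; there)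
open import Data.List.Properties using (map-tabulate; length-tabulate)
open import Data.Nat using (ℕ; zero; suc; _+_; _*_; _∸_; _^_; _≤_; _<_; _<ᵇ_; z≤n; z<s)
open import Data.Nat.Properties
  using ( +-0-commutativeMonoid; +-assoc; +-identityʳ; +-cancelʳ-≡; +-cancelˡ-<; *-distribˡ-+
        ; ≤-refl; ≤-reflexive; ≤-trans; ≤-<-trans; <-≤-trans; <-asym; <ᵇ⇒<
        ; +-mono-≤; +-monoˡ-≤; +-monoʳ-<; *-mono-≤; *-monoˡ-≤; *-monoʳ-≤; ∸-monoˡ-≤; *-cancelˡ-<
        ; m≤m+n; m≤n+m; m<m+n; m≤n*m; m+n∸n≡m; m+n≤o⇒m≤o∸n; module ≤-Reasoning )
import Data.Nat.ListAction as ListAction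
open import Data.Nat.Tactic.RingSolver using (solve-∀)
open import Data.Nat.Solver using (module +-*-Solver)
open import Data.Product using (Σ; ∃; _×_; _,_; proj₁; proj₂)
open import Function using (_∘_; id)
open import Relation.Binary.PropositionalEquality as ≡
  using (_≡_; _≢_; refl; cong; cong₂; subst; subst₂; trans; module ≡-Reasoning)
open import Relation.Nullary using (does; yes; no; ¬_; contradiction)
open import Relation.Nullary.Decidable using (dec-true)
open import Algebra.Properties.CommutativeMonoid.Sum +-0-commutativeMonoid
  using (sum-syntax; sum-cong-≗; sum-replicate-zero; ∑-distrib-+; ∑-comm)

private
  variable
    n : ℕ

𝟙 : Bool → ℕ
𝟙 true  = 1
𝟙 false = 0

𝟙-mono : ∀ {a b} → (a ≡ true → b ≡ true) → 𝟙 a ≤ 𝟙 b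
𝟙-mono {false}         _   = z≤n
𝟙-mono {true}  {true}  _   = ≤-refl
𝟙-mono {true}  {false} a⇒b with () ← a⇒b refl

𝟙-positive : ∀ {b} → 0 < 𝟙 b → b ≡ true
𝟙-positive {true} _ = refl

𝟙-∧-disjoint : ∀ a b c → (T a → ¬ T b) → 𝟙 (a ∧ c) + 𝟙 (b ∧ c) ≤ 𝟙 c
𝟙-∧-disjoint true  true  c a⇒¬b = ⊥-elim (a⇒¬b _ _)
𝟙-∧-disjoint true  false c a⇒¬b = ≤-reflexive (+-identityʳ (𝟙 c))
𝟙-∧-disjoint false true  c a⇒¬b = ≤-refl
𝟙-∧-disjoint false false c a⇒¬b = z≤n

∑-mono-≤ : {f g : Fin n → ℕ} → (∀ i → f i ≤ g i) → ∑[ i < n ] f i ≤ ∑[ i < n ] g i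
∑-mono-≤ {zero}  _   = z≤n
∑-mono-≤ {suc n} f≤g = +-mono-≤ (f≤g zero) (∑-mono-≤ (f≤g ∘ suc))

∑-positive : (f : Fin n → ℕ) → 0 < ∑[ i < n ] f i → ∃ λ i → 0 < f i
∑-positive {suc n} f ∑f>0 with f zero in eq
... | suc _ = zero , subst (0 <_) (≡.sym eq) z<s
... | zero  = let i , fi>0 = ∑-positive (f ∘ suc) ∑f>0 in suc i , fi>0

δ : Fin n → Fin n → ℕ
δ v i = 𝟙 (does (v ≟ i))

∑-δ : (v : Fin n) (f : Fin n → ℕ) → ∑[ i < n ] (δ v i * f i) ≡ f v
∑-δ {suc n} zero    f = trans (cong₂ _+_ (+-identityʳ (f zero)) (sum-replicate-zero n)) (+-identityʳ (f zero))
∑-δ {suc n} (suc v) f = ∑-δ v (f ∘ suc)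

∑∑-distrib-+ : ∀ {m} (f g : Fin n → Fin m → ℕ) →
  ∑[ i < n ] ∑[ j < m ] (f i j + g i j) ≡ ∑[ i < n ] ∑[ j < m ] f i j + ∑[ i < n ] ∑[ j < m ] g i j
∑∑-distrib-+ {n} {m} f g =
  trans (sum-cong-≗ λ i → ∑-distrib-+ (f i) (g i)) (∑-distrib-+ (λ i → ∑[ j < m ] f i j) (λ i → ∑[ j < m ] g i j))

∑∑-δ : (v : Fin n) (w : Fin n → Fin n → ℕ) →
  ∑[ i < n ] ∑[ j < n ] (δ v i * w i j + δ v j * w i j) ≡ ∑[ j < n ] (w v j + w j v)
∑∑-δ {n} v w = begin
  ∑[ i < n ] ∑[ j < n ] (δ v i * w i j + δ v j * w i j)
    ≡⟨ ∑∑-distrib-+ (λ i j → δ v i * w i j) (λ i j → δ v j * w i j) ⟩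
  ∑[ i < n ] ∑[ j < n ] (δ v i * w i j) + ∑[ i < n ] ∑[ j < n ] (δ v j * w i j)
    ≡⟨ cong₂ _+_ (trans (∑-comm (λ i j → δ v i * w i j)) (sum-cong-≗ λ j → ∑-δ v (λ i → w i j)))
                 (sum-cong-≗ λ i → ∑-δ v (w i)) ⟩
  ∑[ j < n ] w v j + ∑[ i < n ] w i v
    ≡⟨ ≡.sym (∑-distrib-+ (w v) (λ j → w j v)) ⟩
  ∑[ j < n ] (w v j + w j v) ∎
  where open ≡-Reasoning

sum-map-allFin : (f : Fin n → ℕ) → ListAction.sum (map f (allFin n)) ≡ ∑[ i < n ] f i
sum-map-allFin f = trans (cong ListAction.sum (map-tabulate id f)) (sum-tabulate f)
  where
  sum-tabulate : ∀ {n} (f : Fin n → ℕ) → ListAction.sum (tabulate f) ≡ ∑[ i < n ] f i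
  sum-tabulate {zero}  f = refl
  sum-tabulate {suc n} f = cong (f zero +_) (sum-tabulate (f ∘ suc))

-- degree and edges are defined with a private 0/1 indicator of Defs that cannot be named here.
-- In the two-vertex graph whose edge is present iff b, the degree of vertex 0 normalises to that
-- indicator at b, plus 0; degree≡∑ and edges≡∑ use this to replace it by 𝟙.
edgeGraph : Bool → Graph 2
edgeGraph b = record { adj = edge ; sym = edge-sym ; irrefl = λ { 0F → refl ; 1F → refl } }
  where
  edge : Fin 2 → Fin 2 → Bool
  edge 0F 1F = b
  edge 1F 0F = b
  edge _  _  = false
  edge-sym : ∀ u v → edge u v ≡ edge v u
  edge-sym 0F 0F = refl
  edge-sym 0F 1F = refl
  edge-sym 1F 0F = refl
  edge-sym 1F 1F = refl

degree-edgeGraph : ∀ b → degree (edgeGraph b) 0F ≡ 𝟙 b + 0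
degree-edgeGraph true  = refl
degree-edgeGraph false = refl

degree≡∑ : (H : Graph n) (v : Fin n) → degree H v ≡ ∑[ u < n ] 𝟙 (adj H v u)
degree≡∑ {n} H v = trans (sum-map-allFin {n} _)
  (sum-cong-≗ λ u → +-cancelʳ-≡ 0 _ _ (degree-edgeGraph (adj H v u)))

upperAdj : Graph n → Fin n → Fin n → ℕ
upperAdj H i j = 𝟙 ((toℕ i <ᵇ toℕ j) ∧ adj H i j)

edges≡∑ : (H : Graph n) → edges H ≡ ∑[ i < n ] ∑[ j < n ] upperAdj H i j
edges≡∑ {n} H = trans (sum-map-allFin {n} _) (sum-cong-≗ λ i → trans (sum-map-allFin {n} _)
  (sum-cong-≗ λ j → +-cancelʳ-≡ 0 _ _ (degree-edgeGraph ((toℕ i <ᵇ toℕ j) ∧ adj H i j))))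

upperAdj-pair≤adj : (H : Graph n) (v j : Fin n) → upperAdj H v j + upperAdj H j v ≤ 𝟙 (adj H v j)
upperAdj-pair≤adj H v j rewrite sym H j v = 𝟙-∧-disjoint (toℕ v <ᵇ toℕ j) (toℕ j <ᵇ toℕ v) (adj H v j)
  (λ v<j j<v → <-asym (<ᵇ⇒< (toℕ v) (toℕ j) v<j) (<ᵇ⇒< (toℕ j) (toℕ v) j<v))

_⊆ᴳ_ : Graph n → Graph n → Set
H ⊆ᴳ G = ∀ a b → adj H a b ≡ true → adj G a b ≡ true

removeVertex : Graph n → Fin n → Graph n
removeVertex H v = record
  { adj    = λ a b → not (does (v ≟ a) ∨ does (v ≟ b)) ∧ adj H a b
  ; sym    = λ a b → cong₂ (λ x y → not x ∧ y) (∨-comm (does (v ≟ a)) _) (sym H a b)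
  ; irrefl = λ a → trans (cong (_ ∧_) (irrefl H a)) (∧-zeroʳ _)
  }

removeVertex-⊆ : (H : Graph n) (v : Fin n) → removeVertex H v ⊆ᴳ H
removeVertex-⊆ H v a b = ∧-conicalʳ _ (adj H a b)

upperAdj-removeVertex : (H : Graph n) (v i j : Fin n) →
  upperAdj H i j ≤ δ v i * upperAdj H i j + δ v j * upperAdj H i j + upperAdj (removeVertex H v) i j
upperAdj-removeVertex H v i j with v ≟ i | v ≟ j
... | yes refl | _        = ≤-trans (m≤n*m _ 1) (≤-trans (m≤m+n _ _) (m≤m+n _ _))
... | no _     | yes refl = ≤-trans (m≤n*m _ 1) (m≤m+n _ _)
... | no _     | no _     = ≤-refl

edges-removeVertex : (H : Graph n) (v : Fin n) → edges H ≤ degree H v + edges (removeVertex H v)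
edges-removeVertex {n} H v = begin
  edges H                                                    ≡⟨ edges≡∑ H ⟩
  ∑[ i < n ] ∑[ j < n ] u i j                                ≤⟨ ∑-mono-≤ (∑-mono-≤ ∘ upperAdj-removeVertex H v) ⟩
  ∑[ i < n ] ∑[ j < n ] (δ v i * u i j + δ v j * u i j + u′ i j)
                                                             ≡⟨ ∑∑-distrib-+ (λ i j → δ v i * u i j + δ v j * u i j) u′ ⟩
  ∑[ i < n ] ∑[ j < n ] (δ v i * u i j + δ v j * u i j) + ∑[ i < n ] ∑[ j < n ] u′ i j
                                                             ≡⟨ cong₂ _+_ (∑∑-δ v u) (≡.sym (edges≡∑ H′)) ⟩
  ∑[ j < n ] (u v j + u j v) + edges H′                      ≤⟨ +-monoˡ-≤ (edges H′) (∑-mono-≤ (upperAdj-pair≤adj H v)) ⟩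
  ∑[ j < n ] 𝟙 (adj H v j) + edges H′                        ≡⟨ cong (_+ edges H′) (≡.sym (degree≡∑ H v)) ⟩
  degree H v + edges H′                                      ∎
  where
  open ≤-Reasoning
  H′ = removeVertex H v
  u  = upperAdj H
  u′ = upperAdj H′

degree-mono : {H G : Graph n} → H ⊆ᴳ G → ∀ v → degree H v ≤ degree G v
degree-mono {n} {H} {G} H⊆G v = begin
  degree H v                  ≡⟨ degree≡∑ H v ⟩
  ∑[ u < n ] 𝟙 (adj H v u)    ≤⟨ ∑-mono-≤ (λ u → 𝟙-mono (H⊆G v u)) ⟩
  ∑[ u < n ] 𝟙 (adj G v u)    ≡⟨ ≡.sym (degree≡∑ G v) ⟩
  degree G v                  ∎
  where open ≤-Reasoning

maxDegree-⊆ : ∀ {d} {H G : Graph n} → H ⊆ᴳ G → MaxDegreeAtMost G d → MaxDegreeAtMost H d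
maxDegree-⊆ {H = H} {G} H⊆G Δ≤d v = ≤-trans (degree-mono {H = H} {G} H⊆G v) (Δ≤d v)

HasNeighbour : Graph n → Fin n → Set
HasNeighbour H a = ∃ λ b → adj H a b ≡ true

removeVertex-isolates : (H : Graph n) (v : Fin n) → ¬ HasNeighbour (removeVertex H v) v
removeVertex-isolates H v (b , vb) rewrite dec-true (v ≟ v) refl with () ← vb

removeVertices : Graph n → List (Fin n) → Graph n
removeVertices = foldl removeVertex

removeVertices-⊆ : (H : Graph n) (L : List (Fin n)) → removeVertices H L ⊆ᴳ H
removeVertices-⊆ H []      a b ab = ab
removeVertices-⊆ H (v ∷ L) a b ab = removeVertex-⊆ H v a b (removeVertices-⊆ (removeVertex H v) L a b ab)

removeVertices-isolates : (H : Graph n) {L : List (Fin n)} {a : Fin n} → a ∈ L →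
                          ¬ HasNeighbour (removeVertices H L) a
removeVertices-isolates H {v ∷ L} (here refl) (b , ab) =
  removeVertex-isolates H v (b , removeVertices-⊆ (removeVertex H v) L v b ab)
removeVertices-isolates H {v ∷ L} (there a∈L) = removeVertices-isolates (removeVertex H v) a∈L

edges-removeVertices : ∀ {d} (H : Graph n) → MaxDegreeAtMost H d → (L : List (Fin n)) →
                       edges H ≤ length L * d + edges (removeVertices H L)
edges-removeVertices H Δ≤d [] = ≤-refl
edges-removeVertices {d = d} H Δ≤d (v ∷ L) = begin
  edges H                                                   ≤⟨ edges-removeVertex H v ⟩
  degree H v + edges H′                                     ≤⟨ +-mono-≤ (Δ≤d v) (edges-removeVertices H′ Δ′≤d L) ⟩
  d + (length L * d + edges (removeVertices H′ L))          ≡⟨ ≡.sym (+-assoc d _ _) ⟩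
  length (v ∷ L) * d + edges (removeVertices H (v ∷ L))     ∎
  where
  open ≤-Reasoning
  H′ = removeVertex H v
  Δ′≤d = maxDegree-⊆ {H = H′} {H} (removeVertex-⊆ H v) Δ≤d

embedding-⊆ : ∀ {t} {T : Graph t} {H G : Graph n} {f : Fin t → Fin n} →
              H ⊆ᴳ G → IsEmbedding T H f → IsEmbedding T G f
embedding-⊆ H⊆G (f-inj , f-hom) = f-inj , λ u v uv → H⊆G _ _ (f-hom u v uv)

embedding-hasNeighbour : ∀ {t} {T : Graph t} {H : Graph n} {f : Fin t → Fin n} →
                         IsEmbedding T H f → ∀ {u} → HasNeighbour T u → HasNeighbour H (f u)
embedding-hasNeighbour (_ , f-hom) (w , uw) = _ , f-hom _ w uw

reach-hasNeighbour : ∀ {t} {T : Graph t} {u w} → Reach T u w → u ≢ w → HasNeighbour T u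
reach-hasNeighbour here                u≢u = ⊥-elim (u≢u refl)
reach-hasNeighbour (step {w = x} ux _) _   = x , ux

connected-hasNeighbour : ∀ {t} {T : Graph (suc (suc t))} → Connected T → ∀ u → HasNeighbour T u
connected-hasNeighbour conn 0F      = reach-hasNeighbour (conn 0F 1F) λ ()
connected-hasNeighbour conn (suc u) = reach-hasNeighbour (conn (suc u) 0F) λ ()

edges-positive-hasNeighbour : (H : Graph n) → 0 < edges H → ∃ (HasNeighbour H)
edges-positive-hasNeighbour H e>0 =
  let i , ∑uij>0 = ∑-positive _ (subst (0 <_) (edges≡∑ H) e>0)
      j , uij>0  = ∑-positive (upperAdj H i) ∑uij>0
  in  i , j , ∧-conicalʳ _ (adj H i j) (𝟙-positive uij>0)

point-embedding : (T : Graph 1) (H : Graph n) (a : Fin n) → IsEmbedding T H (λ _ → a)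
point-embedding T H a = (λ { 0F 0F _ → refl }) , λ { 0F 0F uu → contradiction (trans (≡.sym uu) (irrefl T 0F)) λ () }

embedTree : ErdosSos → ∀ {t} (T : Graph t) → IsTree T → ∀ s → t ≤ s + 2 →
            (H : Graph n) → s * n < 2 * edges H →
            Σ (Fin t → Fin n) λ f → IsEmbedding T H f × (∀ u → HasNeighbour H (f u))
embedTree es {zero} T (() , _) s t≤s+2 H sn<2e
embedTree es {1} T _ s t≤s+2 H sn<2e =
  let a , a-nb = edges-positive-hasNeighbour H (*-cancelˡ-< 2 0 (edges H) (≤-<-trans z≤n sn<2e))
  in  (λ _ → a) , point-embedding T H a , λ _ → a-nb
embedTree {n} es {t@(suc (suc _))} T T-tree@(_ , T-conn , _) s t≤s+2 H sn<2e =
  let f , f-emb = es t T T-tree n H (≤-<-trans (*-monoˡ-≤ n t∸2≤s) sn<2e)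
  in  f , f-emb , λ u → embedding-hasNeighbour {T = T} {H} f-emb (connected-hasNeighbour T-conn u)
  where
  t∸2≤s : t ∸ 2 ≤ s
  t∸2≤s = subst (t ∸ 2 ≤_) (m+n∸n≡m s 2) (∸-monoˡ-≤ 2 t≤s+2)

ContainsDisjointUnionOnNonIsolated : ∀ {N} → Graph n → (t : Fin N → ℕ) → ((i : Fin N) → Graph (t i)) → Set
ContainsDisjointUnionOnNonIsolated H t T =
  Σ (ContainsDisjointUnion H t T) λ (f , _) → ∀ i u → HasNeighbour H (f i u)

disjointUnion-∷ : ∀ {N} {t : Fin (suc N) → ℕ} {T : (i : Fin (suc N)) → Graph (t i)}
                  (H : Graph n) {f₀ : Fin (t 0F) → Fin n} →
                  IsEmbedding (T 0F) H f₀ → (∀ u → HasNeighbour H (f₀ u)) →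
                  ContainsDisjointUnionOnNonIsolated (removeVertices H (tabulate f₀)) (t ∘ suc) (T ∘ suc) →
                  ContainsDisjointUnionOnNonIsolated H t T
disjointUnion-∷ {n} {N} {t} {T} H {f₀} f₀-emb f₀-nb ((g , g-emb , g-disj) , g-nb) =
  (f , f-emb , f-disj) , f-nb
  where
  H′ = removeVertices H (tabulate f₀)
  H′⊆H = removeVertices-⊆ H (tabulate f₀)

  f : (i : Fin (suc N)) → Fin (t i) → Fin n
  f 0F      = f₀
  f (suc i) = g i

  f-emb : ∀ i → IsEmbedding (T i) H (f i)
  f-emb 0F      = f₀-emb
  f-emb (suc i) = embedding-⊆ {T = T (suc i)} {H′} {H} H′⊆H (g-emb i)

  f₀≢g : ∀ u i v → f₀ u ≢ g i v
  f₀≢g u i v f₀u≡giv =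
    removeVertices-isolates H (∈-tabulate⁺ u) (subst (HasNeighbour H′) (≡.sym f₀u≡giv) (g-nb i v))

  f-disj : ∀ i j u v → i ≢ j → f i u ≢ f j v
  f-disj 0F      0F      u v 0≢0 = ⊥-elim (0≢0 refl)
  f-disj 0F      (suc j) u v _   = f₀≢g u j v
  f-disj (suc i) 0F      u v _   = f₀≢g v i u ∘ ≡.sym
  f-disj (suc i) (suc j) u v i≢j = g-disj i j u v (i≢j ∘ cong suc)

  f-nb : ∀ i u → HasNeighbour H (f i u)
  f-nb 0F      = f₀-nb
  f-nb (suc i) u = let b , ab = g-nb i u in b , H′⊆H _ b ab

budget-step : ∀ a b c e → a + 2 * (c + b) < 2 * (c + e) → a + 2 * b < 2 * e
budget-step a b c e = +-cancelˡ-< (2 * c) (a + 2 * b) (2 * e) ∘ subst₂ _<_ (regroup a b c) (*-distribˡ-+ 2 c e)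
  where
  regroup : ∀ a b c → a + 2 * (c + b) ≡ 2 * c + (a + 2 * b)
  regroup = solve-∀

-- The budget says s·n/2 + (N − 1)·c < e(H), where c = (s + 2)·d bounds the edges lost
-- when the vertices of one tree are deleted; it is stated without truncated subtraction.
embedDisjointTrees : ErdosSos → ∀ s {d} (H : Graph n) → MaxDegreeAtMost H d →
  ∀ N (t : Fin N → ℕ) (T : (i : Fin N) → Graph (t i)) → (∀ i → IsTree (T i) × t i ≤ s + 2) →
  s * n + 2 * (N * ((s + 2) * d)) < 2 * ((s + 2) * d + edges H) →
  ContainsDisjointUnionOnNonIsolated H t T
embedDisjointTrees es s H Δ≤d zero t T trees _ = ((λ ()) , (λ ()) , λ ()) , λ ()
embedDisjointTrees {n} es s {d} H Δ≤d (suc N) t T trees budget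
  with budget-rest ← budget-step (s * n) (N * ((s + 2) * d)) ((s + 2) * d) (edges H) budget
  with f₀ , f₀-emb , f₀-nb ← embedTree es (T 0F) (proj₁ (trees 0F)) s (proj₂ (trees 0F)) H
                               (≤-<-trans (m≤m+n (s * n) _) budget-rest)
  = disjointUnion-∷ {t = t} {T} H f₀-emb f₀-nb
      (embedDisjointTrees es s H′ Δ′≤d N (t ∘ suc) (T ∘ suc) (trees ∘ suc) budget′)
  where
  c = (s + 2) * d
  H′ = removeVertices H (tabulate f₀)
  Δ′≤d = maxDegree-⊆ {H = H′} {H} (removeVertices-⊆ H (tabulate f₀)) Δ≤d

  edges-H : edges H ≤ c + edges H′
  edges-H = begin
    edges H                                    ≤⟨ edges-removeVertices H Δ≤d (tabulate f₀) ⟩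
    length (tabulate f₀) * d + edges H′        ≡⟨ cong (λ l → l * d + edges H′) (length-tabulate f₀) ⟩
    t 0F * d + edges H′                        ≤⟨ +-monoˡ-≤ (edges H′) (*-monoˡ-≤ d (proj₂ (trees 0F))) ⟩
    c + edges H′                               ∎
    where open ≤-Reasoning

  budget′ : s * n + 2 * (N * c) < 2 * (c + edges H′)
  budget′ = <-≤-trans budget-rest (*-monoʳ-≤ 2 edges-H)


-- 6k³ − 2 · 2k · (k + 2)(k − 1) = 2k((k − 1)² + 3) > 0, written with k = suc m.
treesCost<6k³ : ∀ m s N → s ≤ suc m → N ≤ 2 * suc m → 2 * (N * ((s + 2) * m)) < 6 * suc m ^ 3
treesCost<6k³ m s N s≤k N≤2k = begin-strict
  2 * (N * ((s + 2) * m))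
    ≤⟨ *-monoʳ-≤ 2 (*-mono-≤ N≤2k (*-monoˡ-≤ m (+-monoˡ-≤ 2 s≤k))) ⟩
  2 * (2 * suc m * ((suc m + 2) * m))
    <⟨ m<m+n _ z<s ⟩
  2 * (2 * suc m * ((suc m + 2) * m)) + 2 * suc m * (3 + m * m)
    ≡⟨ cube-split m ⟩
  6 * suc m ^ 3 ∎
  where
  open ≤-Reasoning
  cube-split : ∀ m → 2 * (2 * suc m * ((suc m + 2) * m)) + 2 * suc m * (3 + m * m) ≡ 6 * suc m ^ 3
  cube-split = solve 1 (λ m →
    con 2 :* (con 2 :* (con 1 :+ m) :* ((con 1 :+ m :+ con 2) :* m)) :+ con 2 :* (con 1 :+ m) :* (con 3 :+ m :* m)
      := con 6 :* (con 1 :+ m) :^ 3) refl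
    where open +-*-Solver

lemma3p2 : ErdosSos →
    ∀ (k k' : ℕ) → k' ≤ k →
    ∀ (n : ℕ) (G : Graph n) → 3 * k ^ 3 ≤ n →
    (∀ v → degree G v + 1 ≤ k) →
    k' * n + 6 * k ^ 3 ≤ 2 * edges G →
    ∀ (N : ℕ) → N ≤ 2 * k →
    ∀ (t : Fin N → ℕ) (T : (i : Fin N) → Graph (t i)) →
    (∀ i → IsTree (T i) × t i ≤ k' + 2) →
    ContainsDisjointUnion G t T
lemma3p2 es zero    k' _    n G _ _     _       zero    _     t T _     = (λ ()) , (λ ()) , λ ()
lemma3p2 es (suc m) k' k'≤k n G _ deg<k e-large N       N≤2k  t T trees =
  proj₁ (embedDisjointTrees es k' G Δ≤m N t T trees budget)
  where
  Δ≤m : MaxDegreeAtMost G m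
  Δ≤m v = m+n≤o⇒m≤o∸n (degree G v) (deg<k v)

  budget : k' * n + 2 * (N * ((k' + 2) * m)) < 2 * ((k' + 2) * m + edges G)
  budget = begin-strict
    k' * n + 2 * (N * ((k' + 2) * m))   <⟨ +-monoʳ-< (k' * n) (treesCost<6k³ m k' N k'≤k N≤2k) ⟩
    k' * n + 6 * suc m ^ 3              ≤⟨ e-large ⟩
    2 * edges G                         ≤⟨ *-monoʳ-≤ 2 (m≤n+m (edges G) ((k' + 2) * m)) ⟩
    2 * ((k' + 2) * m + edges G)        ∎
    where open ≤-Reasoning
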